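{- Let $n,\Delta>0$ be integers and $\mu,\eta$ positive reals. Let $V$ be a set of size $n$ and let $\mathcal B\subseteq\binom V\Delta$ be a family of $\Delta$-sets with $|\mathcal B|\le\mu n^\Delta$. Then at most $(\Delta!/\eta^{\Delta-1})\mu n$ vertices of $V$ are $\eta n$-corrupted by $\mathcal B$.
   Context: Corruption: for $\mathcal B\subseteq\binom V\Delta$ and a real $x>0$, every $B\in\mathcal B$ is called $x$-corrupted by $\mathcal B$; recursively, for $i=\Delta-1,\dots,1$, an $i$-set $B\subseteq V$ is $x$-corrupted by $\mathcal B$ if it is contained in more than $x$ of the $(i+1)$-sets that are $x$-corrupted by $\mathcal B$. A vertex $v$ is $x$-corrupted if the $1$-set $\{v\}$ is.
   Formalization: The parameters μ and η range over the positive rationals instead of the positive reals. -}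

module Defs where

open import Data.Nat as ℕ using (ℕ; zero; suc; _∸_)
open import Data.Bool as Bool using (Bool; true; false; _∧_)
open import Data.List using (List; []; _∷_; map; length; _++_; filterᵇ)
open import Data.Bool.ListAction using (any)
open import Data.Vec using (_∷_; [])
open import Data.Vec.Properties using (≡-dec)
open import Data.Fin using (Fin)
open import Data.List.Base using () renaming (allFin to allFinL)
open import Data.Fin.Subset using (Subset; ∣_∣; ⁅_⁆; inside; outside)
open import Data.Fin.Subset.Properties using (_⊆?_)
open import Data.Integer as ℤ using (+_)
open import Data.Rational as ℚ using (ℚ; _*_; 1ℚ)
open import Data.Rational.Properties using (_<?_)
open import Relation.Nullary using (does)

toℚ : ℕ → ℚ
toℚ k = (+ k) ℚ./ 1

_^ℚ_ : ℚ → ℕ → ℚ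
q ^ℚ zero = 1ℚ
q ^ℚ suc k = q * (q ^ℚ k)

allSubsets : ∀ n → List (Subset n)
allSubsets zero = [] ∷ []
allSubsets (suc n) = map (inside ∷_) s ++ map (outside ∷_) s
  where s = allSubsets n

-- corruptedAt Δ x 𝓑 d B : the (Δ ∸ d)-set B is x-corrupted by 𝓑.
-- depth 0: B ∈ 𝓑 (the Δ-sets in 𝓑 are x-corrupted by definition);
-- depth d+1: B is a (Δ-(d+1))-set contained in more than x of the
-- (Δ-d)-sets that are x-corrupted (depth d).
corruptedAt : ∀ {n} (Δ : ℕ) (x : ℚ) (𝓑 : List (Subset n)) (d : ℕ) → Subset n → Bool
corruptedAt Δ x 𝓑 zero B = any (λ C → does (≡-dec Bool._≟_ C B)) 𝓑
corruptedAt {n} Δ x 𝓑 (suc d) B =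
  does (∣ B ∣ ℕ.≟ (Δ ∸ suc d))
  ∧ does (x <? toℚ (length (filterᵇ
        (λ C → does (B ⊆? C) ∧ does (∣ C ∣ ℕ.≟ (Δ ∸ d)) ∧ corruptedAt Δ x 𝓑 d C)
        (allSubsets n))))

vertexCorrupted : ∀ {n} (Δ : ℕ) (x : ℚ) (𝓑 : List (Subset n)) → Fin n → Bool
vertexCorrupted Δ x 𝓑 v = corruptedAt Δ x 𝓑 (Δ ∸ 1) ⁅ v ⁆

numCorruptedVertices : ∀ {n} (Δ : ℕ) (x : ℚ) (𝓑 : List (Subset n)) → ℕ
numCorruptedVertices {n} Δ x 𝓑 = length (filterᵇ (vertexCorrupted Δ x 𝓑) (allFinL n))

-- Let c_d be the number of x-corrupted (Δ - d)-sets, so c_0 ≤ |𝓑|.  Each corrupted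
-- (Δ - d - 1)-set lies in more than x corrupted (Δ - d)-sets, while each (Δ - d)-set
-- contains only Δ - d sets of size one less; double counting the incidences gives
-- x c_{d+1} ≤ (Δ - d) c_d.  Iterating down to the vertices (d = Δ - 1) yields
-- x^(Δ-1) c_{Δ-1} ≤ Δ! |𝓑|, and x = η n, |𝓑| ≤ μ n^Δ finish the bound.
{-# OPTIONS --safe #-}
module Submission where

open import Defs
open import Data.Nat using (ℕ)
open import Data.Rational using (ℚ)
open import Data.Bool as Bool using (Bool; true; false; _∧_; _∨_)
open import Data.Bool.ListAction using (any)
open import Data.List using (List; []; _∷_; map; length; _++_; filterᵇ; allFin)
open import Data.Fin as Fin using (Fin)
open import Data.Fin.Subset using (Subset; ∣_∣; ⁅_⁆; ⊥; inside; outside)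
open import Data.Fin.Subset.Properties using (_⊆?_)
open import Data.Vec using ([]; _∷_)
open import Data.Vec.Properties using (≡-dec)
open import Function using (_∘_; id)
open import Relation.Nullary using (does; yes; no; Dec)
open import Relation.Binary.PropositionalEquality

module NatSums where

  open import Data.Nat
  open import Data.Nat.Properties
  open import Data.Nat.ListAction using (sum)
  open import Data.Nat.ListAction.Properties using (sum-++)
  open import Data.List.Properties using (map-++; map-∘; map-cong)
  open import Data.Nat.Solver using (module +-*-Solver)
  open +-*-Solver

  𝟙 : Bool → ℕ
  𝟙 true  = 1
  𝟙 false = 0

  ∑ : {A : Set} → List A → (A → ℕ) → ℕ
  ∑ xs f = sum (map f xs)

  private variable A B : Set

  ∑-++ : ∀ xs ys (f : A → ℕ) → ∑ (xs ++ ys) f ≡ ∑ xs f + ∑ ys f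
  ∑-++ xs ys f = trans (cong sum (map-++ f xs ys)) (sum-++ (map f xs) (map f ys))

  ∑-map : ∀ (g : A → B) xs (f : B → ℕ) → ∑ (map g xs) f ≡ ∑ xs (f ∘ g)
  ∑-map g xs f = cong sum (sym (map-∘ xs))

  ∑-cong : ∀ xs {f g : A → ℕ} → (∀ x → f x ≡ g x) → ∑ xs f ≡ ∑ xs g
  ∑-cong xs f≗g = cong sum (map-cong f≗g xs)

  ∑-mono-≤ : ∀ xs {f g : A → ℕ} → (∀ x → f x ≤ g x) → ∑ xs f ≤ ∑ xs g
  ∑-mono-≤ []       f≤g = z≤n
  ∑-mono-≤ (x ∷ xs) f≤g = +-mono-≤ (f≤g x) (∑-mono-≤ xs f≤g)

  ∑-zero : ∀ (xs : List A) → ∑ xs (λ _ → 0) ≡ 0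
  ∑-zero []       = refl
  ∑-zero (x ∷ xs) = ∑-zero xs

  ∑-one : ∀ (xs : List A) → ∑ xs (λ _ → 1) ≡ length xs
  ∑-one []       = refl
  ∑-one (x ∷ xs) = cong suc (∑-one xs)

  ∑-+ : ∀ xs (f g : A → ℕ) → ∑ xs (λ x → f x + g x) ≡ ∑ xs f + ∑ xs g
  ∑-+ []       f g = refl
  ∑-+ (x ∷ xs) f g = trans (cong (f x + g x +_) (∑-+ xs f g))
    (solve 4 (λ a b c d → (a :+ b) :+ (c :+ d) := (a :+ c) :+ (b :+ d)) refl
      (f x) (g x) (∑ xs f) (∑ xs g))

  *-distribˡ-∑ : ∀ xs k (f : A → ℕ) → k * ∑ xs f ≡ ∑ xs (λ x → k * f x)
  *-distribˡ-∑ []       k f = *-zeroʳ k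
  *-distribˡ-∑ (x ∷ xs) k f = trans (*-distribˡ-+ k (f x) (∑ xs f))
    (cong (k * f x +_) (*-distribˡ-∑ xs k f))

  ∑-comm : ∀ xs (ys : List B) (h : A → B → ℕ) →
    ∑ xs (λ x → ∑ ys (h x)) ≡ ∑ ys (λ y → ∑ xs (λ x → h x y))
  ∑-comm []       ys h = sym (∑-zero ys)
  ∑-comm (x ∷ xs) ys h = trans (cong (∑ ys (h x) +_) (∑-comm xs ys h))
    (sym (∑-+ ys (h x) (λ y → ∑ xs (λ x′ → h x′ y))))

  length-filterᵇ : ∀ (p : A → Bool) xs → length (filterᵇ p xs) ≡ ∑ xs (𝟙 ∘ p)
  length-filterᵇ p []       = refl
  length-filterᵇ p (x ∷ xs) with p x
  ... | true  = cong suc (length-filterᵇ p xs)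
  ... | false = length-filterᵇ p xs

  𝟙-any-≤ : ∀ (p : A → Bool) xs → 𝟙 (any p xs) ≤ ∑ xs (𝟙 ∘ p)
  𝟙-any-≤ p []       = z≤n
  𝟙-any-≤ p (x ∷ xs) = ≤-trans (𝟙-∨-≤ (p x) (any p xs)) (+-monoʳ-≤ (𝟙 (p x)) (𝟙-any-≤ p xs))
    where
    𝟙-∨-≤ : ∀ a b → 𝟙 (a ∨ b) ≤ 𝟙 a + 𝟙 b
    𝟙-∨-≤ true  b = s≤s z≤n
    𝟙-∨-≤ false b = ≤-refl

  𝟙-∧ : ∀ a b → 𝟙 (a ∧ b) ≡ 𝟙 a * 𝟙 b
  𝟙-∧ true  b = sym (+-identityʳ (𝟙 b))
  𝟙-∧ false b = refl

open NatSums

module SubsetCounting where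

  open import Data.Nat
  open import Data.Nat.Properties
  open import Data.Nat.Combinatorics using (_C_; nCk+nC[k+1]≡[n+1]C[k+1]; nCk≡nC[n∸k]; nC1≡n)
  open import Data.List.Properties using (map-tabulate)
  open import Data.Bool.Properties using (∧-zeroʳ)
  open import Data.Nat.Solver using (module +-*-Solver)
  open +-*-Solver

  ofSize : ∀ {n} → ℕ → Subset n → Bool
  ofSize k B = does (∣ B ∣ ≟ k)

  ∑-allSubsets-suc : ∀ n (f : Subset (suc n) → ℕ) →
    ∑ (allSubsets (suc n)) f ≡ ∑ (allSubsets n) (f ∘ (inside ∷_)) + ∑ (allSubsets n) (f ∘ (outside ∷_))
  ∑-allSubsets-suc n f = trans (∑-++ (map (inside ∷_) (allSubsets n)) _ f)
    (cong₂ _+_ (∑-map (inside ∷_) (allSubsets n) f) (∑-map (outside ∷_) (allSubsets n) f))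

  allSubsets-contains-once : ∀ n (S : Subset n) → ∑ (allSubsets n) (λ B → 𝟙 (does (≡-dec Bool._≟_ S B))) ≡ 1
  allSubsets-contains-once zero    []            = refl
  allSubsets-contains-once (suc n) (inside ∷ S)  = trans (∑-allSubsets-suc n _)
    (cong₂ _+_ (allSubsets-contains-once n S) (∑-zero (allSubsets n)))
  allSubsets-contains-once (suc n) (outside ∷ S) = trans (∑-allSubsets-suc n _)
    (cong₂ _+_ (∑-zero (allSubsets n)) (allSubsets-contains-once n S))

  count-⊆-ofSize : ∀ n (S : Subset n) k →
    ∑ (allSubsets n) (λ B → 𝟙 (does (B ⊆? S) ∧ ofSize k B)) ≡ ∣ S ∣ C k
  count-⊆-ofSize zero    []            zero    = refl
  count-⊆-ofSize zero    []            (suc k) = refl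
  count-⊆-ofSize (suc n) (inside ∷ S)  zero    = trans (∑-allSubsets-suc n _)
    (cong₂ _+_ (trans (∑-cong (allSubsets n) (λ B → cong 𝟙 (∧-zeroʳ (does (B ⊆? S)))))
                      (∑-zero (allSubsets n)))
               (count-⊆-ofSize n S zero))
  count-⊆-ofSize (suc n) (inside ∷ S)  (suc k) = trans (∑-allSubsets-suc n _)
    (trans (cong₂ _+_ (count-⊆-ofSize n S k) (count-⊆-ofSize n S (suc k)))
           (nCk+nC[k+1]≡[n+1]C[k+1] ∣ S ∣ k))
  count-⊆-ofSize (suc n) (outside ∷ S) k       = trans (∑-allSubsets-suc n _)
    (trans (cong (_+ ∑ (allSubsets n) (λ B → 𝟙 (does (B ⊆? S) ∧ ofSize k B))) (∑-zero (allSubsets n)))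
           (count-⊆-ofSize n S k))

  count-facets : ∀ n (S : Subset n) k → ∣ S ∣ ≡ suc k →
    ∑ (allSubsets n) (λ B → 𝟙 (does (B ⊆? S) ∧ ofSize k B)) ≡ suc k
  count-facets n S k ∣S∣≡1+k = begin
    ∑ (allSubsets n) (λ B → 𝟙 (does (B ⊆? S) ∧ ofSize k B)) ≡⟨ count-⊆-ofSize n S k ⟩
    ∣ S ∣ C k                                                ≡⟨ cong (_C k) ∣S∣≡1+k ⟩
    suc k C k                                                ≡⟨ nCk≡nC[n∸k] (n≤1+n k) ⟩
    suc k C (suc k ∸ k)                                      ≡⟨ cong (suc k C_) (m+n∸n≡m 1 k) ⟩
    suc k C 1                                                ≡⟨ nC1≡n (suc k) ⟩
    suc k                                                    ∎
    where open ≡-Reasoning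

  ∑-allFin-suc : ∀ n (h : Fin (suc n) → ℕ) → ∑ (allFin (suc n)) h ≡ h Fin.zero + ∑ (allFin n) (h ∘ Fin.suc)
  ∑-allFin-suc n h = cong (h Fin.zero +_)
    (trans (cong (λ vs → ∑ vs h) (sym (map-tabulate id Fin.suc))) (∑-map Fin.suc (allFin n) h))

  ⊥-≤-∑-allSubsets : ∀ n (g : Subset n → ℕ) → g ⊥ ≤ ∑ (allSubsets n) g
  ⊥-≤-∑-allSubsets zero    g = m≤m+n (g []) 0
  ⊥-≤-∑-allSubsets (suc n) g = ≤-trans (⊥-≤-∑-allSubsets n (g ∘ (outside ∷_)))
    (≤-trans (m≤n+m _ _) (≤-reflexive (sym (∑-allSubsets-suc n g))))

  ∑-singletons-≤-∑-allSubsets : ∀ n (g : Subset n → ℕ) → ∑ (allFin n) (g ∘ ⁅_⁆) ≤ ∑ (allSubsets n) g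
  ∑-singletons-≤-∑-allSubsets zero    g = z≤n
  ∑-singletons-≤-∑-allSubsets (suc n) g = begin
    ∑ (allFin (suc n)) (g ∘ ⁅_⁆)
      ≡⟨ ∑-allFin-suc n (g ∘ ⁅_⁆) ⟩
    g (inside ∷ ⊥) + ∑ (allFin n) (g ∘ (outside ∷_) ∘ ⁅_⁆)
      ≤⟨ +-mono-≤ (⊥-≤-∑-allSubsets n (g ∘ (inside ∷_))) (∑-singletons-≤-∑-allSubsets n (g ∘ (outside ∷_))) ⟩
    ∑ (allSubsets n) (g ∘ (inside ∷_)) + ∑ (allSubsets n) (g ∘ (outside ∷_))
      ≡⟨ ∑-allSubsets-suc n g ⟨
    ∑ (allSubsets (suc n)) g ∎
    where open ≤-Reasoning

  ∑-supersets-ofSize-≤ : ∀ {n} (f : Subset n → Bool) {m k} → m ≡ suc k →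
    ∑ (allSubsets n) (λ B → 𝟙 (ofSize k B) * ∑ (allSubsets n) (λ S → 𝟙 (does (B ⊆? S) ∧ ofSize m S ∧ f S)))
      ≤ m * ∑ (allSubsets n) (𝟙 ∘ f)
  ∑-supersets-ofSize-≤ {n} f {m} {k} m≡1+k = begin
    ∑ 𝒫 (λ B → 𝟙 (ofSize k B) * ∑ 𝒫 (λ S → 𝟙 (does (B ⊆? S) ∧ ofSize m S ∧ f S)))
      ≡⟨ ∑-cong 𝒫 (λ B → *-distribˡ-∑ 𝒫 (𝟙 (ofSize k B)) _) ⟩
    ∑ 𝒫 (λ B → ∑ 𝒫 (λ S → 𝟙 (ofSize k B) * 𝟙 (does (B ⊆? S) ∧ ofSize m S ∧ f S)))
      ≡⟨ ∑-comm 𝒫 𝒫 _ ⟩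
    ∑ 𝒫 (λ S → ∑ 𝒫 (λ B → 𝟙 (ofSize k B) * 𝟙 (does (B ⊆? S) ∧ ofSize m S ∧ f S)))
      ≡⟨ ∑-cong 𝒫 (λ S → trans (∑-cong 𝒫 (λ B → 𝟙-∧-exchange (ofSize k B) (does (B ⊆? S)) _))
                              (sym (*-distribˡ-∑ 𝒫 (𝟙 (ofSize m S ∧ f S)) _))) ⟩
    ∑ 𝒫 (λ S → 𝟙 (ofSize m S ∧ f S) * ∑ 𝒫 (λ B → 𝟙 (does (B ⊆? S) ∧ ofSize k B)))
      ≤⟨ ∑-mono-≤ 𝒫 (λ S → facets-bound S (∣ S ∣ ≟ m)) ⟩
    ∑ 𝒫 (λ S → m * 𝟙 (f S))
      ≡⟨ *-distribˡ-∑ 𝒫 m (𝟙 ∘ f) ⟨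
    m * ∑ 𝒫 (𝟙 ∘ f) ∎
    where
    open ≤-Reasoning
    𝒫 : List (Subset n)
    𝒫 = allSubsets n

    𝟙-∧-exchange : ∀ a p q → 𝟙 a * 𝟙 (p ∧ q) ≡ 𝟙 q * 𝟙 (p ∧ a)
    𝟙-∧-exchange a p q = begin-equality
      𝟙 a * 𝟙 (p ∧ q)     ≡⟨ cong (𝟙 a *_) (𝟙-∧ p q) ⟩
      𝟙 a * (𝟙 p * 𝟙 q)   ≡⟨ solve 3 (λ a p q → a :* (p :* q) := q :* (p :* a)) refl (𝟙 a) (𝟙 p) (𝟙 q) ⟩
      𝟙 q * (𝟙 p * 𝟙 a)   ≡⟨ cong (𝟙 q *_) (𝟙-∧ p a) ⟨
      𝟙 q * 𝟙 (p ∧ a)     ∎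

    facets-bound : ∀ S (∣S∣≟m : Dec (∣ S ∣ ≡ m)) →
      𝟙 (does ∣S∣≟m ∧ f S) * ∑ 𝒫 (λ B → 𝟙 (does (B ⊆? S) ∧ ofSize k B)) ≤ m * 𝟙 (f S)
    facets-bound S (yes ∣S∣≡m) = ≤-reflexive (begin-equality
      𝟙 (f S) * ∑ 𝒫 (λ B → 𝟙 (does (B ⊆? S) ∧ ofSize k B))
        ≡⟨ cong (𝟙 (f S) *_) (count-facets n S k (trans ∣S∣≡m m≡1+k)) ⟩
      𝟙 (f S) * suc k ≡⟨ *-comm (𝟙 (f S)) (suc k) ⟩
      suc k * 𝟙 (f S) ≡⟨ cong (_* 𝟙 (f S)) m≡1+k ⟨
      m * 𝟙 (f S) ∎)
    facets-bound S (no _)      = z≤n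

open SubsetCounting

module NatEmbedding where

  open import Data.Nat as ℕ using (ℕ; zero; suc)
  import Data.Nat.Properties as ℕ
  open import Data.Integer as ℤ using (+_)
  import Data.Integer.Properties as ℤ
  open import Data.Rational using (ℚ; 1ℚ; _≤_; _<_; _+_; _*_; toℚᵘ; NonNegative; Positive)
  open import Data.Rational.Properties
  open import Data.Rational.Unnormalised as ℚᵘ using (mkℚᵘ; *≡*; *≤*)
  import Data.Rational.Unnormalised.Properties as ℚᵘ
  open import Data.Rational.Solver using (module +-*-Solver)
  open +-*-Solver

  toℚᵘ-toℚ : ∀ k → toℚᵘ (toℚ k) ℚᵘ.≃ mkℚᵘ (+ k) 0
  toℚᵘ-toℚ k = toℚᵘ-fromℚᵘ (mkℚᵘ (+ k) 0)

  toℚ-+ : ∀ a b → toℚ (a ℕ.+ b) ≡ toℚ a + toℚ b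
  toℚ-+ a b = toℚᵘ-injective (begin
    toℚᵘ (toℚ (a ℕ.+ b))            ≈⟨ toℚᵘ-toℚ (a ℕ.+ b) ⟩
    mkℚᵘ (+ (a ℕ.+ b)) 0             ≈⟨ *≡* (cong (ℤ._* + 1) +[a+b]≡+a*1++b*1) ⟩
    mkℚᵘ (+ a) 0 ℚᵘ.+ mkℚᵘ (+ b) 0   ≈⟨ ℚᵘ.+-cong (toℚᵘ-toℚ a) (toℚᵘ-toℚ b) ⟨
    toℚᵘ (toℚ a) ℚᵘ.+ toℚᵘ (toℚ b)   ≈⟨ toℚᵘ-homo-+ (toℚ a) (toℚ b) ⟨
    toℚᵘ (toℚ a + toℚ b)             ∎)
    where
    open ℚᵘ.≃-Reasoning
    +[a+b]≡+a*1++b*1 : + (a ℕ.+ b) ≡ + a ℤ.* + 1 ℤ.+ + b ℤ.* + 1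
    +[a+b]≡+a*1++b*1 = trans (ℤ.pos-+ a b) (sym (cong₂ ℤ._+_ (ℤ.*-identityʳ (+ a)) (ℤ.*-identityʳ (+ b))))

  toℚ-* : ∀ a b → toℚ (a ℕ.* b) ≡ toℚ a * toℚ b
  toℚ-* a b = toℚᵘ-injective (begin
    toℚᵘ (toℚ (a ℕ.* b))            ≈⟨ toℚᵘ-toℚ (a ℕ.* b) ⟩
    mkℚᵘ (+ (a ℕ.* b)) 0             ≈⟨ *≡* (cong (ℤ._* + 1) (ℤ.pos-* a b)) ⟩
    mkℚᵘ (+ a) 0 ℚᵘ.* mkℚᵘ (+ b) 0   ≈⟨ ℚᵘ.*-cong (toℚᵘ-toℚ a) (toℚᵘ-toℚ b) ⟨
    toℚᵘ (toℚ a) ℚᵘ.* toℚᵘ (toℚ b)   ≈⟨ toℚᵘ-homo-* (toℚ a) (toℚ b) ⟨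
    toℚᵘ (toℚ a * toℚ b)             ∎)
    where open ℚᵘ.≃-Reasoning

  toℚ-mono-≤ : ∀ {a b} → a ℕ.≤ b → toℚ a ≤ toℚ b
  toℚ-mono-≤ {a} {b} a≤b = toℚᵘ-cancel-≤ (begin
    toℚᵘ (toℚ a) ≃⟨ toℚᵘ-toℚ a ⟩
    mkℚᵘ (+ a) 0 ≤⟨ *≤* (ℤ.*-monoʳ-≤-nonNeg (+ 1) (ℤ.+≤+ a≤b)) ⟩
    mkℚᵘ (+ b) 0 ≃⟨ toℚᵘ-toℚ b ⟨
    toℚᵘ (toℚ b) ∎)
    where open ℚᵘ.≤-Reasoning

  toℚ-*-monoˡ-≤ : ∀ k {p q} → p ≤ q → toℚ k * p ≤ toℚ k * q
  toℚ-*-monoˡ-≤ k = *-monoˡ-≤-nonNeg (toℚ k) {{normalize-nonNeg k 1}}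

  ^ℚ-nonNeg : ∀ x .{{_ : NonNegative x}} d → NonNegative (x ^ℚ d)
  ^ℚ-nonNeg x zero    = _
  ^ℚ-nonNeg x (suc d) = nonNeg*nonNeg⇒nonNeg x (x ^ℚ d) {{^ℚ-nonNeg x d}}

  ^ℚ-pos : ∀ x .{{_ : Positive x}} d → Positive (x ^ℚ d)
  ^ℚ-pos x zero    = _
  ^ℚ-pos x (suc d) = pos*pos⇒pos x (x ^ℚ d) {{^ℚ-pos x d}}

  ^ℚ-distribʳ-* : ∀ a b d → (a * b) ^ℚ d ≡ a ^ℚ d * b ^ℚ d
  ^ℚ-distribʳ-* a b zero    = sym (*-identityˡ 1ℚ)
  ^ℚ-distribʳ-* a b (suc d) = trans (cong ((a * b) *_) (^ℚ-distribʳ-* a b d))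
    (solve 4 (λ a b A B → (a :* b) :* (A :* B) := (a :* A) :* (b :* B)) refl a b (a ^ℚ d) (b ^ℚ d))

  *-toℚ-∑-≤ : ∀ {A : Set} x .{{_ : NonNegative x}} (xs : List A) (f g : A → ℕ) →
    (∀ a → x * toℚ (f a) ≤ toℚ (g a)) → x * toℚ (∑ xs f) ≤ toℚ (∑ xs g)
  *-toℚ-∑-≤ x []       f g xf≤g = ≤-reflexive (*-zeroʳ x)
  *-toℚ-∑-≤ x (a ∷ xs) f g xf≤g = begin
    x * toℚ (f a ℕ.+ ∑ xs f)            ≡⟨ cong (x *_) (toℚ-+ (f a) (∑ xs f)) ⟩
    x * (toℚ (f a) + toℚ (∑ xs f))      ≡⟨ *-distribˡ-+ x (toℚ (f a)) (toℚ (∑ xs f)) ⟩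
    x * toℚ (f a) + x * toℚ (∑ xs f)    ≤⟨ +-mono-≤ (xf≤g a) (*-toℚ-∑-≤ x xs f g xf≤g) ⟩
    toℚ (g a) + toℚ (∑ xs g)            ≡⟨ toℚ-+ (g a) (∑ xs g) ⟨
    toℚ (g a ℕ.+ ∑ xs g)                ∎
    where open ≤-Reasoning

  -- The decision is an argument rather than a `with x <? toℚ L`, whose abstraction
  -- makes Agda normalise the rational toℚ L and is prohibitively slow.
  *-toℚ-𝟙-∧-<-≤ : ∀ x .{{_ : NonNegative x}} a L (x<?L : Dec (x < toℚ L)) →
    x * toℚ (𝟙 (a ∧ does x<?L)) ≤ toℚ (𝟙 a ℕ.* L)
  *-toℚ-𝟙-∧-<-≤ x false L _         = ≤-reflexive (*-zeroʳ x)
  *-toℚ-𝟙-∧-<-≤ x true  L (no _)    = ≤-trans (≤-reflexive (*-zeroʳ x)) (toℚ-mono-≤ {b = 1 ℕ.* L} ℕ.z≤n)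
  *-toℚ-𝟙-∧-<-≤ x true  L (yes x<L) = begin
    x * 1ℚ          ≡⟨ *-identityʳ x ⟩
    x               ≤⟨ <⇒≤ x<L ⟩
    toℚ L           ≡⟨ cong toℚ (ℕ.*-identityˡ L) ⟨
    toℚ (1 ℕ.* L)   ∎
    where open ≤-Reasoning

open NatEmbedding

module Corruption {n : ℕ} (Δ : ℕ) (x : ℚ) (𝓑 : List (Subset n)) where

  open import Data.Nat as ℕ using (ℕ; zero; suc; _∸_; _!)
  import Data.Nat.Properties as ℕ
  open import Data.Rational using (_≤_; _*_; _<?_; NonNegative)
  open import Data.Rational.Properties
  open import Data.Rational.Solver using (module +-*-Solver)
  open +-*-Solver

  𝒫 : List (Subset n)
  𝒫 = allSubsets n

  #corrupted : ℕ → ℕ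
  #corrupted d = ∑ 𝒫 (𝟙 ∘ corruptedAt Δ x 𝓑 d)

  #corrupted-zero-≤ : #corrupted 0 ℕ.≤ length 𝓑
  #corrupted-zero-≤ = begin
    ∑ 𝒫 (λ B → 𝟙 (any (λ C → does (≡-dec Bool._≟_ C B)) 𝓑))
      ≤⟨ ∑-mono-≤ 𝒫 (λ B → 𝟙-any-≤ (λ C → does (≡-dec Bool._≟_ C B)) 𝓑) ⟩
    ∑ 𝒫 (λ B → ∑ 𝓑 (λ C → 𝟙 (does (≡-dec Bool._≟_ C B))))
      ≡⟨ ∑-comm 𝒫 𝓑 _ ⟩
    ∑ 𝓑 (λ C → ∑ 𝒫 (λ B → 𝟙 (does (≡-dec Bool._≟_ C B))))
      ≡⟨ ∑-cong 𝓑 (allSubsets-contains-once n) ⟩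
    ∑ 𝓑 (λ _ → 1)
      ≡⟨ ∑-one 𝓑 ⟩
    length 𝓑 ∎
    where open ℕ.≤-Reasoning

  numCorruptedVertices-≤ : numCorruptedVertices Δ x 𝓑 ℕ.≤ #corrupted (Δ ∸ 1)
  numCorruptedVertices-≤ = ℕ.≤-trans
    (ℕ.≤-reflexive (length-filterᵇ (vertexCorrupted Δ x 𝓑) (allFin n)))
    (∑-singletons-≤-∑-allSubsets n (𝟙 ∘ corruptedAt Δ x 𝓑 (Δ ∸ 1)))

  m∸n≡1+m∸[1+n] : ∀ {m n} → suc n ℕ.≤ m → m ∸ n ≡ suc (m ∸ suc n)
  m∸n≡1+m∸[1+n] = ℕ.+-∸-assoc 1

  module _ .{{_ : NonNegative x}} where

    *-#corrupted-suc-≤ : ∀ d → suc d ℕ.≤ Δ → x * toℚ (#corrupted (suc d)) ≤ toℚ ((Δ ∸ d) ℕ.* #corrupted d)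
    *-#corrupted-suc-≤ d 1+d≤Δ = begin
      x * toℚ (#corrupted (suc d))
        ≤⟨ *-toℚ-∑-≤ x 𝒫 _ _ (λ B → *-toℚ-𝟙-∧-<-≤ x (ofSize k B) _ (x <? toℚ (length (filterᵇ (supersets B) 𝒫)))) ⟩
      toℚ (∑ 𝒫 (λ B → 𝟙 (ofSize k B) ℕ.* length (filterᵇ (supersets B) 𝒫)))
        ≡⟨ cong toℚ (∑-cong 𝒫 (λ B → cong (𝟙 (ofSize k B) ℕ.*_) (length-filterᵇ (supersets B) 𝒫))) ⟩
      toℚ (∑ 𝒫 (λ B → 𝟙 (ofSize k B) ℕ.* ∑ 𝒫 (𝟙 ∘ supersets B)))
        ≤⟨ toℚ-mono-≤ (∑-supersets-ofSize-≤ (corruptedAt Δ x 𝓑 d) (m∸n≡1+m∸[1+n] 1+d≤Δ)) ⟩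
      toℚ ((Δ ∸ d) ℕ.* #corrupted d) ∎
      where
      open ≤-Reasoning
      k : ℕ
      k = Δ ∸ suc d
      supersets : Subset n → Subset n → Bool
      supersets B C = does (B ⊆? C) ∧ ofSize (Δ ∸ d) C ∧ corruptedAt Δ x 𝓑 d C

    ^ℚ-*-#corrupted-≤ : ∀ d → d ℕ.< Δ →
      toℚ ((Δ ∸ d) !) * (x ^ℚ d * toℚ (#corrupted d)) ≤ toℚ (Δ !) * toℚ (#corrupted 0)
    ^ℚ-*-#corrupted-≤ zero    _      = ≤-reflexive (cong (toℚ (Δ !) *_) (*-identityˡ (toℚ (#corrupted 0))))
    ^ℚ-*-#corrupted-≤ (suc d) 1+d<Δ = begin
      toℚ (K !) * ((x * x ^ℚ d) * toℚ (#corrupted (suc d)))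
        ≡⟨ solve 4 (λ F x X C → F :* ((x :* X) :* C) := F :* (X :* (x :* C))) refl
             (toℚ (K !)) x (x ^ℚ d) (toℚ (#corrupted (suc d))) ⟩
      toℚ (K !) * (x ^ℚ d * (x * toℚ (#corrupted (suc d))))
        ≤⟨ toℚ-*-monoˡ-≤ (K !) (*-monoˡ-≤-nonNeg (x ^ℚ d) {{^ℚ-nonNeg x d}}
             (*-#corrupted-suc-≤ d (ℕ.<⇒≤ 1+d<Δ))) ⟩
      toℚ (K !) * (x ^ℚ d * toℚ ((Δ ∸ d) ℕ.* #corrupted d))
        ≡⟨ cong (λ t → toℚ (K !) * (x ^ℚ d * t)) (toℚ-* (Δ ∸ d) (#corrupted d)) ⟩
      toℚ (K !) * (x ^ℚ d * (toℚ (Δ ∸ d) * toℚ (#corrupted d)))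
        ≡⟨ solve 4 (λ F X S C → F :* (X :* (S :* C)) := (S :* F) :* (X :* C)) refl
             (toℚ (K !)) (x ^ℚ d) (toℚ (Δ ∸ d)) (toℚ (#corrupted d)) ⟩
      (toℚ (Δ ∸ d) * toℚ (K !)) * (x ^ℚ d * toℚ (#corrupted d))
        ≡⟨ cong (_* (x ^ℚ d * toℚ (#corrupted d))) toℚ[Δ∸d]!≡toℚ[Δ∸d]*toℚ[K!] ⟨
      toℚ ((Δ ∸ d) !) * (x ^ℚ d * toℚ (#corrupted d))
        ≤⟨ ^ℚ-*-#corrupted-≤ d (ℕ.<-trans (ℕ.n<1+n d) 1+d<Δ) ⟩
      toℚ (Δ !) * toℚ (#corrupted 0) ∎
      where
      open ≤-Reasoning
      K : ℕ
      K = Δ ∸ suc d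
      Δ∸d≡1+K : Δ ∸ d ≡ suc K
      Δ∸d≡1+K = m∸n≡1+m∸[1+n] (ℕ.<⇒≤ 1+d<Δ)
      toℚ[Δ∸d]!≡toℚ[Δ∸d]*toℚ[K!] : toℚ ((Δ ∸ d) !) ≡ toℚ (Δ ∸ d) * toℚ (K !)
      toℚ[Δ∸d]!≡toℚ[Δ∸d]*toℚ[K!] = begin-equality
        toℚ ((Δ ∸ d) !)          ≡⟨ cong (λ m → toℚ (m !)) Δ∸d≡1+K ⟩
        toℚ (suc K ℕ.* K !)      ≡⟨ toℚ-* (suc K) (K !) ⟩
        toℚ (suc K) * toℚ (K !)  ≡⟨ cong (λ m → toℚ m * toℚ (K !)) Δ∸d≡1+K ⟨
        toℚ (Δ ∸ d) * toℚ (K !)  ∎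

open import Data.Nat as ℕ using (zero; suc; _∸_; _!)
import Data.Nat.Properties as ℕ
open import Data.List.Relation.Unary.All using (All)
open import Data.List.Relation.Unary.Unique.Propositional using (Unique)
open import Data.Rational as ℚ using (0ℚ; 1ℚ; _<_; _≤_; _*_; NonNegative; Positive)
open import Data.Rational.Properties
open import Data.Rational.Solver using (module +-*-Solver)
open +-*-Solver

corrupted-vertices-bound : ∀ {n} D x .{{_ : NonNegative x}} (𝓑 : List (Subset n)) →
  x ^ℚ D * toℚ (numCorruptedVertices (suc D) x 𝓑) ≤ toℚ (suc D !) * toℚ (length 𝓑)
corrupted-vertices-bound D x 𝓑 = begin
  x ^ℚ D * toℚ (numCorruptedVertices (suc D) x 𝓑)
    ≤⟨ *-monoˡ-≤-nonNeg (x ^ℚ D) {{^ℚ-nonNeg x D}} (toℚ-mono-≤ numCorruptedVertices-≤) ⟩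
  x ^ℚ D * toℚ (#corrupted D)
    ≡⟨ *-identityˡ (x ^ℚ D * toℚ (#corrupted D)) ⟨
  toℚ (1 !) * (x ^ℚ D * toℚ (#corrupted D))
    ≡⟨ cong (λ m → toℚ (m !) * (x ^ℚ D * toℚ (#corrupted D))) (ℕ.m+n∸n≡m 1 D) ⟨
  toℚ ((suc D ∸ D) !) * (x ^ℚ D * toℚ (#corrupted D))
    ≤⟨ ^ℚ-*-#corrupted-≤ D (ℕ.n<1+n D) ⟩
  toℚ (suc D !) * toℚ (#corrupted 0)
    ≤⟨ toℚ-*-monoˡ-≤ (suc D !) (toℚ-mono-≤ #corrupted-zero-≤) ⟩
  toℚ (suc D !) * toℚ (length 𝓑) ∎
  where
  open ≤-Reasoning
  open Corruption (suc D) x 𝓑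

lemma11p7 : (n Δ : ℕ) → 0 ℕ.< n → 0 ℕ.< Δ → (μ η : ℚ) → 0ℚ < μ → 0ℚ < η →
    (𝓑 : List (Subset n)) → Unique 𝓑 → All (λ B → ∣ B ∣ ≡ Δ) 𝓑 →
    toℚ (length 𝓑) ≤ μ * (toℚ n ^ℚ Δ) →
    (η ^ℚ (Δ ∸ 1)) * toℚ (numCorruptedVertices Δ (η * toℚ n) 𝓑)
      ≤ toℚ (Δ !) * μ * toℚ n
-- The bound c_0 ≤ |𝓑| holds for any list 𝓑.
lemma11p7 n zero    _   ()
lemma11p7 n (suc D) 0<n _ μ η _ 0<η 𝓑 _ _ ∣𝓑∣≤μNᵟ = *-cancelʳ-≤-pos (N ^ℚ D) {{^ℚ-pos N D}} (begin
  η ^ℚ D * toℚ v * N ^ℚ D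
    ≡⟨ solve 3 (λ E V M → (E :* V) :* M := (E :* M) :* V) refl (η ^ℚ D) (toℚ v) (N ^ℚ D) ⟩
  η ^ℚ D * N ^ℚ D * toℚ v
    ≡⟨ cong (_* toℚ v) (^ℚ-distribʳ-* η N D) ⟨
  (η * N) ^ℚ D * toℚ v
    ≤⟨ corrupted-vertices-bound D (η * N) 𝓑 ⟩
  toℚ (suc D !) * toℚ (length 𝓑)
    ≤⟨ toℚ-*-monoˡ-≤ (suc D !) ∣𝓑∣≤μNᵟ ⟩
  toℚ (suc D !) * (μ * (N * N ^ℚ D))
    ≡⟨ solve 4 (λ F μ N M → F :* (μ :* (N :* M)) := ((F :* μ) :* N) :* M) refl (toℚ (suc D !)) μ N (N ^ℚ D) ⟩
  toℚ (suc D !) * μ * N * N ^ℚ D ∎)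
  where
  open ≤-Reasoning
  N : ℚ
  N = toℚ n
  v : ℕ
  v = numCorruptedVertices (suc D) (η * N) 𝓑
  instance
    η-pos : Positive η
    η-pos = ℚ.positive 0<η
    N-pos : Positive N
    N-pos = ℚ.positive (<-≤-trans (positive⁻¹ 1ℚ) (toℚ-mono-≤ 0<n))
    ηN-nonNeg : NonNegative (η * N)
    ηN-nonNeg = pos⇒nonNeg (η * N) {{pos*pos⇒pos η N}}
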